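{- A signed graph whose underlying graph contains an odd number of triangles cannot be sign-symmetric.
   Context: A signed graph $\Gamma=(G,\sigma)$ is a simple graph $G=(V,E)$ with a map $\sigma:E\to\{+1,-1\}$; its adjacency matrix $A(\Gamma)$ has $(i,j)$ entry $\sigma(ij)$ if $ij\in E$ and $0$ otherwise. Its negation is $-\Gamma=(G,-\sigma)$. Two signed graphs are switching isomorphic if their adjacency matrices satisfy $A(\Gamma_2)=PA(\Gamma_1)P^{T}$ for some signed permutation matrix $P$ (a permutation matrix times a diagonal $\pm1$ matrix). $\Gamma$ is sign-symmetric if $\Gamma$ is switching isomorphic to $-\Gamma$. A triangle is a cycle of length $3$ in $G$. -}

module Defs where

open import Data.Nat as ℕ using (ℕ)
open import Data.Integer as ℤ using (ℤ; 0ℤ; 1ℤ; -1ℤ; -_; _*_)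
open import Data.Fin as Fin using (Fin)
open import Data.Fin.Permutation using (Permutation′; _⟨$⟩ʳ_)
open import Data.List using (List; allFin; concatMap; filter; length; _∷_; [])
open import Data.Product using (Σ; _×_; _,_; ∃)
open import Data.Sum using (_⊎_)
open import Relation.Binary.PropositionalEquality using (_≡_; _≢_)
open import Relation.Nullary using (¬_; Dec; yes; no)
open import Relation.Nullary.Decidable using (¬?; _×-dec_)
open import Data.Bool using (Bool; true; false)

-- The underlying simple graph G has edge ij iff A i j ≠ 0, with sign A i j.
record SignedGraph (n : ℕ) : Set where
  field
    adj       : Fin n → Fin n → ℤ
    entries   : ∀ i j → adj i j ≡ 0ℤ ⊎ adj i j ≡ 1ℤ ⊎ adj i j ≡ -1ℤ
    symmetric : ∀ i j → adj i j ≡ adj j i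
    loopless  : ∀ i → adj i i ≡ 0ℤ
open SignedGraph public

negAdj : ∀ {n} → SignedGraph n → Fin n → Fin n → ℤ
negAdj Γ i j = - adj Γ i j

IsSignVector : ∀ {n} → (Fin n → ℤ) → Set
IsSignVector d = ∀ i → d i ≡ 1ℤ ⊎ d i ≡ -1ℤ

-- M₂ = P M₁ Pᵀ for a signed permutation matrix P = D Q, where Q is the
-- permutation matrix with Q i (π i) = 1 and D = diag(d).  Entrywise:
-- (P M₁ Pᵀ) i j = d i * M₁ (π i) (π j) * d j.
SwitchingIsomorphicMat : ∀ {n} → (Fin n → Fin n → ℤ) → (Fin n → Fin n → ℤ) → Set
SwitchingIsomorphicMat {n} M₁ M₂ =
  Σ (Permutation′ n) λ π → Σ (Fin n → ℤ) λ d →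
    IsSignVector d ×
    (∀ i j → M₂ i j ≡ d i * M₁ (π ⟨$⟩ʳ i) (π ⟨$⟩ʳ j) * d j)

SignSymmetric : ∀ {n} → SignedGraph n → Set
SignSymmetric Γ = SwitchingIsomorphicMat (adj Γ) (negAdj Γ)

Adjacent : ∀ {n} → SignedGraph n → Fin n → Fin n → Set
Adjacent Γ i j = adj Γ i j ≢ 0ℤ

adjacent? : ∀ {n} (Γ : SignedGraph n) i j → Dec (Adjacent Γ i j)
adjacent? Γ i j = ¬? (adj Γ i j ℤ.≟ 0ℤ)

triples : (n : ℕ) → List (Fin n × Fin n × Fin n)
triples n = concatMap (λ i → concatMap (λ j → Data.List.map (λ k → (i , j , k)) (allFin n)) (allFin n)) (allFin n)
  where import Data.List

IsTriangle : ∀ {n} → SignedGraph n → Fin n × Fin n × Fin n → Set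
IsTriangle Γ (i , j , k) =
  (i Fin.< j × j Fin.< k) × (Adjacent Γ i j × Adjacent Γ j k × Adjacent Γ i k)

isTriangle? : ∀ {n} (Γ : SignedGraph n) t → Dec (IsTriangle Γ t)
isTriangle? Γ (i , j , k) =
  (i Fin.<? j ×-dec j Fin.<? k) ×-dec
  (adjacent? Γ i j ×-dec adjacent? Γ j k ×-dec adjacent? Γ i k)

numTriangles : ∀ {n} → SignedGraph n → ℕ
numTriangles {n} Γ = length (filter (isTriangle? Γ) (triples n))

-- Count closed walks of length 3, i.e. tr A³ = Σ_{i,j,k} A i j · A j k · A k i.  Every
-- triangle contributes the product of its three signs, once for each of its 6 orderings,
-- and nothing else contributes, so tr A³ = 6 T where T is the sum of the triangle signs.
-- A switching isomorphism preserves tr A³, while negation flips it; hence a sign-symmetric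
-- graph has tr A³ = 0, so T = 0.  But T, a sum of one ±1 per triangle, has the parity of
-- the number of triangles.
module Submission where

open import Defs
open import Data.Nat using (ℕ)
import Data.Nat as ℕ
open import Data.Nat.Divisibility using (_∣_; divides)
open import Relation.Nullary using (¬_)

open import Data.Integer as ℤ using (ℤ; +_; 0ℤ; 1ℤ; -1ℤ; -_; _*_; _+_; -[1+_]; ∣_∣)
import Data.Integer.Properties as ℤP
open import Data.Integer.Tactic.RingSolver using (solve-∀)
open import Data.Fin as Fin using (Fin; _<_)
open import Data.Fin.Properties using (_<?_; _≟_; <-asym; <-trans; <-cmp)
open import Data.Fin.Permutation using (Permutation′; _⟨$⟩ʳ_)
open import Data.List using (List; []; _∷_; allFin; concatMap; filter; length; map; tabulate; foldr; _++_)
open import Data.List.Properties using (foldr-map)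
open import Data.Product using (_×_; _,_; ∃-syntax; proj₁; proj₂)
open import Data.Sum using (_⊎_; inj₁; inj₂)
open import Data.Bool using (if_then_else_)
open import Data.Empty using (⊥-elim)
open import Function using (_∘_; id)
open import Relation.Binary.Definitions using (Tri; tri<; tri≈; tri>)
open import Relation.Binary.PropositionalEquality
open import Relation.Nullary using (Dec; yes; no; does)
open import Relation.Nullary.Decidable using (dec-true; dec-false; decidable-stable; _×-dec_)
open import Relation.Unary using (Decidable)

open import Algebra.Properties.Semiring.Sum ℤP.+-*-semiring
  using (sum-syntax; sum-cong-≗; ∑-distrib-+; ∑-comm; sum-permute; *-distribˡ-sum)

open ≡-Reasoning

IsSign : ℤ → Set
IsSign z = z ≡ 1ℤ ⊎ z ≡ -1ℤ

IsSign-* : ∀ {a b} → IsSign a → IsSign b → IsSign (a * b)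
IsSign-* (inj₁ refl) (inj₁ refl) = inj₁ refl
IsSign-* (inj₁ refl) (inj₂ refl) = inj₂ refl
IsSign-* (inj₂ refl) (inj₁ refl) = inj₂ refl
IsSign-* (inj₂ refl) (inj₂ refl) = inj₁ refl

IsSign⇒square≡1 : ∀ {a} → IsSign a → a * a ≡ 1ℤ
IsSign⇒square≡1 (inj₁ refl) = refl
IsSign⇒square≡1 (inj₂ refl) = refl

i≡-i⇒i≡0 : ∀ i → i ≡ - i → i ≡ 0ℤ
i≡-i⇒i≡0 (+ 0)       _ = refl
i≡-i⇒i≡0 (+ ℕ.suc n) ()
i≡-i⇒i≡0 -[1+ n ]    ()

*-nonzeroˡ : ∀ a b → a * b ≢ 0ℤ → a ≢ 0ℤ
*-nonzeroˡ a b ab≢0 refl = ab≢0 refl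

*-nonzeroʳ : ∀ a b → a * b ≢ 0ℤ → b ≢ 0ℤ
*-nonzeroʳ a b ab≢0 refl = ab≢0 (ℤP.*-zeroʳ a)

indicator : ∀ {A : Set} → Dec A → ℤ
indicator a? = if does a? then 1ℤ else 0ℤ

indicator-true : ∀ {A : Set} (a? : Dec A) → A → indicator a? ≡ 1ℤ
indicator-true a? a rewrite dec-true a? a = refl

indicator-false : ∀ {A : Set} (a? : Dec A) → ¬ A → indicator a? ≡ 0ℤ
indicator-false a? ¬a rewrite dec-false a? ¬a = refl

indicator-nonzero : ∀ {A : Set} (a? : Dec A) → indicator a? ≢ 0ℤ → A
indicator-nonzero (yes a) _   = a
indicator-nonzero (no _)  i≢0 = ⊥-elim (i≢0 refl)

+-cong₆ : ∀ {a b c d e f a′ b′ c′ d′ e′ f′ : ℤ} →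
  a ≡ a′ → b ≡ b′ → c ≡ c′ → d ≡ d′ → e ≡ e′ → f ≡ f′ →
  a + b + (c + d) + (e + f) ≡ a′ + b′ + (c′ + d′) + (e′ + f′)
+-cong₆ refl refl refl refl refl refl = refl

∑ˡ : ∀ {A : Set} → (A → ℤ) → List A → ℤ
∑ˡ w = foldr (λ x s → w x + s) 0ℤ

module _ {A : Set} (w : A → ℤ) where

  ∑ˡ-++ : ∀ xs ys → ∑ˡ w (xs ++ ys) ≡ ∑ˡ w xs + ∑ˡ w ys
  ∑ˡ-++ []       ys = sym (ℤP.+-identityˡ _)
  ∑ˡ-++ (x ∷ xs) ys = trans (cong (_+_ (w x)) (∑ˡ-++ xs ys)) (sym (ℤP.+-assoc (w x) _ _))

  ∑ˡ-concatMap : ∀ {B : Set} (f : B → List A) xs →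
    ∑ˡ w (concatMap f xs) ≡ ∑ˡ (λ x → ∑ˡ w (f x)) xs
  ∑ˡ-concatMap f []       = refl
  ∑ˡ-concatMap f (x ∷ xs) = trans (∑ˡ-++ (f x) _) (cong (_+_ (∑ˡ w (f x))) (∑ˡ-concatMap f xs))

  ∑ˡ-map : ∀ {B : Set} (g : B → A) xs → ∑ˡ w (map g xs) ≡ ∑ˡ (w ∘ g) xs
  ∑ˡ-map g = foldr-map _ g 0ℤ

∑ˡ-tabulate : ∀ {A : Set} {n} (w : A → ℤ) (f : Fin n → A) → ∑ˡ w (tabulate f) ≡ ∑[ i < n ] w (f i)
∑ˡ-tabulate {n = ℕ.zero}  w f = refl
∑ˡ-tabulate {n = ℕ.suc n} w f = cong (_+_ (w (f Fin.zero))) (∑ˡ-tabulate w (f ∘ Fin.suc))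

module _ {A : Set} {P : A → Set} (P? : Decidable P) {w : A → ℤ}
         (sign-on-P : ∀ {x} → P x → IsSign (w x)) (zero-off-P : ∀ {x} → ¬ P x → w x ≡ 0ℤ) where

  length-filter-parity : ∀ xs → ∃[ q ] + length (filter P? xs) ≡ ∑ˡ w xs + q * + 2
  length-filter-parity []       = 0ℤ , refl
  length-filter-parity (x ∷ xs) with P? x | length-filter-parity xs
  ... | no ¬p | q , e = q , (begin
    + length (filter P? xs)        ≡⟨ e ⟩
    ∑ˡ w xs + q * + 2              ≡⟨ cong (λ s → s + q * + 2) (ℤP.+-identityˡ (∑ˡ w xs)) ⟨
    0ℤ + ∑ˡ w xs + q * + 2         ≡⟨ cong (λ a → a + ∑ˡ w xs + q * + 2) (zero-off-P ¬p) ⟨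
    w x + ∑ˡ w xs + q * + 2        ∎)
  ... | yes p | q , e = shift (sign-on-P p)
    where
    shift : IsSign (w x) → ∃[ q′ ] 1ℤ + + length (filter P? xs) ≡ w x + ∑ˡ w xs + q′ * + 2
    shift (inj₁ w≡1)  = q , (begin
      1ℤ + + length (filter P? xs)  ≡⟨ cong (_+_ 1ℤ) e ⟩
      1ℤ + (∑ˡ w xs + q * + 2)      ≡⟨ plus-one (∑ˡ w xs) q ⟩
      1ℤ + ∑ˡ w xs + q * + 2        ≡⟨ cong (λ a → a + ∑ˡ w xs + q * + 2) w≡1 ⟨
      w x + ∑ˡ w xs + q * + 2       ∎)
      where
      plus-one : ∀ s q → 1ℤ + (s + q * + 2) ≡ 1ℤ + s + q * + 2
      plus-one = solve-∀
    shift (inj₂ w≡-1) = q + 1ℤ , (begin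
      1ℤ + + length (filter P? xs)    ≡⟨ cong (_+_ 1ℤ) e ⟩
      1ℤ + (∑ˡ w xs + q * + 2)        ≡⟨ minus-one (∑ˡ w xs) q ⟩
      -1ℤ + ∑ˡ w xs + (q + 1ℤ) * + 2  ≡⟨ cong (λ a → a + ∑ˡ w xs + (q + 1ℤ) * + 2) w≡-1 ⟨
      w x + ∑ˡ w xs + (q + 1ℤ) * + 2  ∎)
      where
      minus-one : ∀ s q → 1ℤ + (s + q * + 2) ≡ -1ℤ + s + (q + 1ℤ) * + 2
      minus-one = solve-∀

module _ {n : ℕ} where

  ∑³ : (Fin n → Fin n → Fin n → ℤ) → ℤ
  ∑³ F = ∑[ i < n ] ∑[ j < n ] ∑[ k < n ] F i j k

  ∑³-cong : ∀ {F G : Fin n → Fin n → Fin n → ℤ} → (∀ i j k → F i j k ≡ G i j k) → ∑³ F ≡ ∑³ G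
  ∑³-cong F≡G = sum-cong-≗ {n} λ i → sum-cong-≗ {n} λ j → sum-cong-≗ {n} λ k → F≡G i j k

  ∑³-distrib-+ : ∀ (F G : Fin n → Fin n → Fin n → ℤ) →
    ∑³ (λ i j k → F i j k + G i j k) ≡ ∑³ F + ∑³ G
  ∑³-distrib-+ F G = trans
    (sum-cong-≗ {n} λ i → trans (sum-cong-≗ {n} λ j → ∑-distrib-+ {n} (F i j) (G i j)) (∑-distrib-+ {n} _ _))
    (∑-distrib-+ {n} _ _)

  *-distribˡ-∑³ : ∀ c (F : Fin n → Fin n → Fin n → ℤ) → c * ∑³ F ≡ ∑³ (λ i j k → c * F i j k)
  *-distribˡ-∑³ c F = trans (*-distribˡ-sum {n} c _)
    (sum-cong-≗ {n} λ i → trans (*-distribˡ-sum {n} c _) (sum-cong-≗ {n} λ j → *-distribˡ-sum {n} c _))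

  ∑³-neg : ∀ (F : Fin n → Fin n → Fin n → ℤ) → ∑³ (λ i j k → - F i j k) ≡ - ∑³ F
  ∑³-neg F = begin
    ∑³ (λ i j k → - F i j k)      ≡⟨ ∑³-cong (λ i j k → sym (ℤP.-1*i≡-i (F i j k))) ⟩
    ∑³ (λ i j k → -1ℤ * F i j k)  ≡⟨ *-distribˡ-∑³ -1ℤ F ⟨
    -1ℤ * ∑³ F                    ≡⟨ ℤP.-1*i≡-i (∑³ F) ⟩
    - ∑³ F                        ∎

  ∑³-swap₁₂ : ∀ (F : Fin n → Fin n → Fin n → ℤ) → ∑³ (λ i j k → F j i k) ≡ ∑³ F
  ∑³-swap₁₂ F = ∑-comm {n} {n} (λ i j → ∑[ k < n ] F j i k)

  ∑³-swap₂₃ : ∀ (F : Fin n → Fin n → Fin n → ℤ) → ∑³ (λ i j k → F i k j) ≡ ∑³ F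
  ∑³-swap₂₃ F = sum-cong-≗ {n} λ i → ∑-comm {n} {n} (λ j k → F i k j)

  ∑³-swap₁₃ : ∀ (F : Fin n → Fin n → Fin n → ℤ) → ∑³ (λ i j k → F k j i) ≡ ∑³ F
  ∑³-swap₁₃ F = begin
    ∑³ (λ i j k → F k j i)  ≡⟨ ∑³-swap₁₂ (λ i j k → F k i j) ⟩
    ∑³ (λ i j k → F k i j)  ≡⟨ ∑³-swap₂₃ (λ i j k → F j i k) ⟩
    ∑³ (λ i j k → F j i k)  ≡⟨ ∑³-swap₁₂ F ⟩
    ∑³ F                    ∎

  ∑³-permute : ∀ (F : Fin n → Fin n → Fin n → ℤ) (π : Permutation′ n) →
    ∑³ (λ i j k → F (π ⟨$⟩ʳ i) (π ⟨$⟩ʳ j) (π ⟨$⟩ʳ k)) ≡ ∑³ F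
  ∑³-permute F π = sym (trans (sum-permute {n} {n} _ π)
    (sum-cong-≗ {n} λ i → trans (sum-permute {n} {n} _ π) (sum-cong-≗ {n} λ j → sum-permute {n} {n} _ π)))

  ∑ˡ-triples : ∀ (w : Fin n × Fin n × Fin n → ℤ) → ∑ˡ w (triples n) ≡ ∑³ λ i j k → w (i , j , k)
  ∑ˡ-triples w = begin
    ∑ˡ w (triples n)                         ≡⟨ ∑ˡ-concatMap w plane (allFin n) ⟩
    ∑ˡ (λ i → ∑ˡ w (plane i)) (allFin n)     ≡⟨ ∑ˡ-tabulate (λ i → ∑ˡ w (plane i)) id ⟩
    ∑[ i < n ] ∑ˡ w (plane i)                ≡⟨ sum-cong-≗ {n} ∑ˡ-plane ⟩
    ∑³ (λ i j k → w (i , j , k))             ∎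
    where
    line : Fin n → Fin n → List (Fin n × Fin n × Fin n)
    line i j = map (λ k → (i , j , k)) (allFin n)

    plane : Fin n → List (Fin n × Fin n × Fin n)
    plane i = concatMap (line i) (allFin n)

    ∑ˡ-line : ∀ i j → ∑ˡ w (line i j) ≡ ∑[ k < n ] w (i , j , k)
    ∑ˡ-line i j = trans (∑ˡ-map w (λ k → (i , j , k)) (allFin n)) (∑ˡ-tabulate (λ k → w (i , j , k)) id)

    ∑ˡ-plane : ∀ i → ∑ˡ w (plane i) ≡ ∑[ j < n ] ∑[ k < n ] w (i , j , k)
    ∑ˡ-plane i = begin
      ∑ˡ w (plane i)                           ≡⟨ ∑ˡ-concatMap w (line i) (allFin n) ⟩
      ∑ˡ (λ j → ∑ˡ w (line i j)) (allFin n)    ≡⟨ ∑ˡ-tabulate (λ j → ∑ˡ w (line i j)) id ⟩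
      ∑[ j < n ] ∑ˡ w (line i j)               ≡⟨ sum-cong-≗ {n} (∑ˡ-line i) ⟩
      ∑[ j < n ] ∑[ k < n ] w (i , j , k)      ∎

  symmetrize₂₃ : (Fin n → Fin n → Fin n → ℤ) → Fin n → Fin n → Fin n → ℤ
  symmetrize₂₃ F i j k = F i j k + F i k j

  -- Every permutation of (i, j, k) is one of id, (12), (13) after one of id, (23).
  symmetrize : (Fin n → Fin n → Fin n → ℤ) → Fin n → Fin n → Fin n → ℤ
  symmetrize F i j k = symmetrize₂₃ F i j k + symmetrize₂₃ F j i k + symmetrize₂₃ F k j i

  ∑³-symmetrize₂₃ : ∀ (F : Fin n → Fin n → Fin n → ℤ) → ∑³ (symmetrize₂₃ F) ≡ + 2 * ∑³ F
  ∑³-symmetrize₂₃ F = begin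
    ∑³ (symmetrize₂₃ F)           ≡⟨ ∑³-distrib-+ F (λ i j k → F i k j) ⟩
    ∑³ F + ∑³ (λ i j k → F i k j) ≡⟨ cong (_+_ (∑³ F)) (∑³-swap₂₃ F) ⟩
    ∑³ F + ∑³ F                   ≡⟨ double (∑³ F) ⟩
    + 2 * ∑³ F                    ∎
    where
    double : ∀ x → x + x ≡ + 2 * x
    double = solve-∀

  ∑³-symmetrize : ∀ (F : Fin n → Fin n → Fin n → ℤ) → ∑³ (symmetrize F) ≡ + 6 * ∑³ F
  ∑³-symmetrize F = begin
    ∑³ (symmetrize F)                                      ≡⟨ ∑³-distrib-+ _ (λ i j k → S k j i) ⟩
    ∑³ (λ i j k → S i j k + S j i k) + ∑³ (λ i j k → S k j i) ≡⟨ cong₂ _+_ (∑³-distrib-+ S _) (∑³-swap₁₃ S) ⟩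
    ∑³ S + ∑³ (λ i j k → S j i k) + ∑³ S                   ≡⟨ cong (λ x → ∑³ S + x + ∑³ S) (∑³-swap₁₂ S) ⟩
    ∑³ S + ∑³ S + ∑³ S                                     ≡⟨ cong (λ x → x + x + x) (∑³-symmetrize₂₃ F) ⟩
    + 2 * ∑³ F + + 2 * ∑³ F + + 2 * ∑³ F                   ≡⟨ sextuple (∑³ F) ⟩
    + 6 * ∑³ F                                             ∎
    where
    S : Fin n → Fin n → Fin n → ℤ
    S = symmetrize₂₃ F
    sextuple : ∀ x → + 2 * x + + 2 * x + + 2 * x ≡ + 6 * x
    sextuple = solve-∀

  symmetrize-swap₁₂ : ∀ (F : Fin n → Fin n → Fin n → ℤ) i j k → symmetrize F j i k ≡ symmetrize F i j k
  symmetrize-swap₁₂ F i j k = reorder (F i j k) (F i k j) (F j i k) (F j k i) (F k j i) (F k i j)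
    where
    reorder : ∀ a b c d e f → c + d + (a + b) + (f + e) ≡ a + b + (c + d) + (e + f)
    reorder = solve-∀

  symmetrize-swap₂₃ : ∀ (F : Fin n → Fin n → Fin n → ℤ) i j k → symmetrize F i k j ≡ symmetrize F i j k
  symmetrize-swap₂₃ F i j k = reorder (F i j k) (F i k j) (F j i k) (F j k i) (F k j i) (F k i j)
    where
    reorder : ∀ a b c d e f → b + a + (f + e) + (d + c) ≡ a + b + (c + d) + (e + f)
    reorder = solve-∀

  Symmetric³ : (Fin n → Fin n → Fin n → ℤ) → Set
  Symmetric³ G = (∀ i j k → G j i k ≡ G i j k) × (∀ i j k → G i k j ≡ G i j k)

  symmetrize-*ʳ : ∀ (F G : Fin n → Fin n → Fin n → ℤ) → Symmetric³ G → ∀ i j k →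
    symmetrize (λ a b c → F a b c * G a b c) i j k ≡ symmetrize F i j k * G i j k
  symmetrize-*ʳ F G (s₁₂ , s₂₃) i j k = trans
    (+-cong₆ (refl {x = F i j k * G i j k}) (cong (F i k j *_) (s₂₃ i j k)) (cong (F j i k *_) (s₁₂ i j k))
             (cong (F j k i *_) (trans (s₂₃ j i k) (s₁₂ i j k)))
             (cong (F k j i *_) (trans (s₁₂ j k i) (trans (s₂₃ j i k) (s₁₂ i j k))))
             (cong (F k i j *_) (trans (s₁₂ i k j) (s₂₃ i j k))))
    (distrib (F i j k) (F i k j) (F j i k) (F j k i) (F k j i) (F k i j) (G i j k))
    where
    distrib : ∀ a b c d e f g → a * g + b * g + (c * g + d * g) + (e * g + f * g) ≡ (a + b + (c + d) + (e + f)) * g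
    distrib = solve-∀

  ascending : Fin n → Fin n → Fin n → ℤ
  ascending i j k = indicator (i <? j ×-dec j <? k)

  symmetrize-ascending-sorted : ∀ {i j k} → i < j → j < k → symmetrize ascending i j k ≡ 1ℤ
  symmetrize-ascending-sorted {i} {j} {k} i<j j<k = +-cong₆
    (indicator-true  (i <? j ×-dec j <? k) (i<j , j<k))
    (indicator-false (i <? k ×-dec k <? j) (<-asym j<k ∘ proj₂))
    (indicator-false (j <? i ×-dec i <? k) (<-asym i<j ∘ proj₁))
    (indicator-false (j <? k ×-dec k <? i) (<-asym i<k ∘ proj₂))
    (indicator-false (k <? j ×-dec j <? i) (<-asym j<k ∘ proj₁))
    (indicator-false (k <? i ×-dec i <? j) (<-asym i<k ∘ proj₁))
    where
    i<k : i < k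
    i<k = <-trans i<j j<k

  symmetrize-ascending-distinct : ∀ {i j k} → i ≢ j → j ≢ k → i ≢ k → symmetrize ascending i j k ≡ 1ℤ
  symmetrize-ascending-distinct {i} {j} {k} i≢j j≢k i≢k = by-order (<-cmp i j) (<-cmp j k) (<-cmp i k)
    where
    swap₁₂ : ∀ a b c → symmetrize ascending b a c ≡ symmetrize ascending a b c
    swap₁₂ = symmetrize-swap₁₂ ascending
    swap₂₃ : ∀ a b c → symmetrize ascending a c b ≡ symmetrize ascending a b c
    swap₂₃ = symmetrize-swap₂₃ ascending

    by-order : Tri (i < j) (i ≡ j) (j < i) → Tri (j < k) (j ≡ k) (k < j) → Tri (i < k) (i ≡ k) (k < i) →
      symmetrize ascending i j k ≡ 1ℤ
    by-order (tri≈ _ i≡j _) _ _ = ⊥-elim (i≢j i≡j)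
    by-order _ (tri≈ _ j≡k _) _ = ⊥-elim (j≢k j≡k)
    by-order _ _ (tri≈ _ i≡k _) = ⊥-elim (i≢k i≡k)
    by-order (tri< i<j _ _) (tri< j<k _ _) _ = symmetrize-ascending-sorted i<j j<k
    by-order (tri< i<j _ _) (tri> _ _ k<j) (tri< i<k _ _) =
      trans (sym (swap₂₃ i j k)) (symmetrize-ascending-sorted i<k k<j)
    by-order (tri< i<j _ _) (tri> _ _ k<j) (tri> _ _ k<i) =
      trans (sym (trans (swap₁₂ i k j) (swap₂₃ i j k))) (symmetrize-ascending-sorted k<i i<j)
    by-order (tri> _ _ j<i) (tri< j<k _ _) (tri< i<k _ _) =
      trans (sym (swap₁₂ i j k)) (symmetrize-ascending-sorted j<i i<k)
    by-order (tri> _ _ j<i) (tri< j<k _ _) (tri> _ _ k<i) =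
      trans (sym (trans (swap₂₃ j i k) (swap₁₂ i j k))) (symmetrize-ascending-sorted j<k k<i)
    by-order (tri> _ _ j<i) (tri> _ _ k<j) _ =
      trans (sym (trans (swap₁₂ j k i) (trans (swap₂₃ j i k) (swap₁₂ i j k))))
            (symmetrize-ascending-sorted k<j j<i)

  cycle³ : (Fin n → Fin n → ℤ) → Fin n → Fin n → Fin n → ℤ
  cycle³ M i j k = M i j * M j k * M k i

  tr³ : (Fin n → Fin n → ℤ) → ℤ
  tr³ M = ∑³ (cycle³ M)

  tr³-neg : ∀ (M : Fin n → Fin n → ℤ) → tr³ (λ i j → - M i j) ≡ - tr³ M
  tr³-neg M = trans (∑³-cong λ i j k → neg³ (M i j) (M j k) (M k i)) (∑³-neg (cycle³ M))
    where
    neg³ : ∀ a b c → - a * - b * - c ≡ - (a * b * c)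
    neg³ = solve-∀

  tr³-switching : ∀ {M₁ M₂ : Fin n → Fin n → ℤ} → SwitchingIsomorphicMat M₁ M₂ → tr³ M₂ ≡ tr³ M₁
  tr³-switching {M₁} {M₂} (π , d , d-sign , M₂≡DM₁D) =
    trans (∑³-cong cycle³-switched) (∑³-permute (cycle³ M₁) π)
    where
    π* : Fin n → Fin n
    π* = π ⟨$⟩ʳ_

    regroup : ∀ x y z a b c →
      x * a * y * (y * b * z) * (z * c * x) ≡ x * x * (y * y * (z * z * (a * b * c)))
    regroup = solve-∀

    drop-ones : ∀ a → 1ℤ * (1ℤ * (1ℤ * a)) ≡ a
    drop-ones = solve-∀

    cycle³-switched : ∀ i j k → cycle³ M₂ i j k ≡ cycle³ M₁ (π* i) (π* j) (π* k)
    cycle³-switched i j k = begin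
      M₂ i j * M₂ j k * M₂ k i
        ≡⟨ cong₂ _*_ (cong₂ _*_ (M₂≡DM₁D i j) (M₂≡DM₁D j k)) (M₂≡DM₁D k i) ⟩
      d i * M₁ (π* i) (π* j) * d j * (d j * M₁ (π* j) (π* k) * d k) * (d k * M₁ (π* k) (π* i) * d i)
        ≡⟨ regroup (d i) (d j) (d k) _ _ _ ⟩
      d i * d i * (d j * d j * (d k * d k * cycle³ M₁ (π* i) (π* j) (π* k)))
        ≡⟨ cong₂ _*_ (IsSign⇒square≡1 (d-sign i)) (cong₂ _*_ (IsSign⇒square≡1 (d-sign j))
             (cong (_* cycle³ M₁ (π* i) (π* j) (π* k)) (IsSign⇒square≡1 (d-sign k)))) ⟩
      1ℤ * (1ℤ * (1ℤ * cycle³ M₁ (π* i) (π* j) (π* k)))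
        ≡⟨ drop-ones _ ⟩
      cycle³ M₁ (π* i) (π* j) (π* k) ∎

signSymmetric⇒tr³≡0 : ∀ {n} (Γ : SignedGraph n) → SignSymmetric Γ → tr³ (adj Γ) ≡ 0ℤ
signSymmetric⇒tr³≡0 Γ sym-Γ =
  i≡-i⇒i≡0 (tr³ (adj Γ)) (trans (sym (tr³-switching {M₁ = adj Γ} {M₂ = negAdj Γ} sym-Γ)) (tr³-neg (adj Γ)))

module _ {n : ℕ} (Γ : SignedGraph n) where

  private
    M : Fin n → Fin n → ℤ
    M = adj Γ

  cycle³-symmetric : Symmetric³ (cycle³ M)
  cycle³-symmetric = swap₁₂ , swap₂₃
    where
    reorder₁₂ : ∀ a b c → a * c * b ≡ a * b * c
    reorder₁₂ = solve-∀
    reorder₂₃ : ∀ a b c → c * b * a ≡ a * b * c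
    reorder₂₃ = solve-∀

    swap₁₂ : ∀ i j k → cycle³ M j i k ≡ cycle³ M i j k
    swap₁₂ i j k rewrite symmetric Γ j i | symmetric Γ i k | symmetric Γ k j =
      reorder₁₂ (M i j) (M j k) (M k i)
    swap₂₃ : ∀ i j k → cycle³ M i k j ≡ cycle³ M i j k
    swap₂₃ i j k rewrite symmetric Γ i k | symmetric Γ k j | symmetric Γ j i =
      reorder₂₃ (M i j) (M j k) (M k i)

  cycle³-diagonal : ∀ {i j k} → i ≡ j ⊎ j ≡ k ⊎ i ≡ k → cycle³ M i j k ≡ 0ℤ
  cycle³-diagonal {i} {_} {k} (inj₁ refl)        rewrite loopless Γ i = refl
  cycle³-diagonal {i} {j} {_} (inj₂ (inj₁ refl)) rewrite loopless Γ j =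
    cong (_* M j i) (ℤP.*-zeroʳ (M i j))
  cycle³-diagonal {i} {j} {_} (inj₂ (inj₂ refl)) rewrite loopless Γ i = ℤP.*-zeroʳ (M i j * M j i)

  cycle³≡symmetrize-ascending : ∀ i j k → cycle³ M i j k ≡ symmetrize ascending i j k * cycle³ M i j k
  cycle³≡symmetrize-ascending i j k = by-equality (i ≟ j) (j ≟ k) (i ≟ k)
    where
    vanishes : i ≡ j ⊎ j ≡ k ⊎ i ≡ k → cycle³ M i j k ≡ symmetrize ascending i j k * cycle³ M i j k
    vanishes degenerate rewrite cycle³-diagonal degenerate = sym (ℤP.*-zeroʳ (symmetrize ascending i j k))

    by-equality : Dec (i ≡ j) → Dec (j ≡ k) → Dec (i ≡ k) →
      cycle³ M i j k ≡ symmetrize ascending i j k * cycle³ M i j k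
    by-equality (yes i≡j) _ _ = vanishes (inj₁ i≡j)
    by-equality _ (yes j≡k) _ = vanishes (inj₂ (inj₁ j≡k))
    by-equality _ _ (yes i≡k) = vanishes (inj₂ (inj₂ i≡k))
    by-equality (no i≢j) (no j≢k) (no i≢k) = sym (begin
      symmetrize ascending i j k * cycle³ M i j k
        ≡⟨ cong (_* cycle³ M i j k) (symmetrize-ascending-distinct i≢j j≢k i≢k) ⟩
      1ℤ * cycle³ M i j k
        ≡⟨ ℤP.*-identityˡ _ ⟩
      cycle³ M i j k ∎)

  triangleWeight : Fin n × Fin n × Fin n → ℤ
  triangleWeight (i , j , k) = ascending i j k * cycle³ M i j k

  signedTriangleSum : ℤ
  signedTriangleSum = ∑³ λ i j k → triangleWeight (i , j , k)

  tr³≡6*signedTriangleSum : tr³ M ≡ + 6 * signedTriangleSum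
  tr³≡6*signedTriangleSum = begin
    ∑³ (cycle³ M)
      ≡⟨ ∑³-cong cycle³≡symmetrize-ascending ⟩
    ∑³ (λ i j k → symmetrize ascending i j k * cycle³ M i j k)
      ≡⟨ ∑³-cong (symmetrize-*ʳ ascending (cycle³ M) cycle³-symmetric) ⟨
    ∑³ (symmetrize (λ i j k → triangleWeight (i , j , k)))
      ≡⟨ ∑³-symmetrize (λ i j k → triangleWeight (i , j , k)) ⟩
    + 6 * signedTriangleSum ∎

  signSymmetric⇒signedTriangleSum≡0 : SignSymmetric Γ → signedTriangleSum ≡ 0ℤ
  signSymmetric⇒signedTriangleSum≡0 sym-Γ = ℤP.*-cancelˡ-≡ (+ 6) signedTriangleSum 0ℤ (begin
    + 6 * signedTriangleSum  ≡⟨ tr³≡6*signedTriangleSum ⟨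
    tr³ M                    ≡⟨ signSymmetric⇒tr³≡0 Γ sym-Γ ⟩
    0ℤ                       ≡⟨ ℤP.*-zeroʳ (+ 6) ⟨
    + 6 * 0ℤ                 ∎)

  private
    IsSign-entry : ∀ {i j} → Adjacent Γ i j → IsSign (M i j)
    IsSign-entry {i} {j} i~j with entries Γ i j
    ... | inj₁ Mij≡0 = ⊥-elim (i~j Mij≡0)
    ... | inj₂ sign  = sign

  triangleWeight-sign : ∀ t → IsTriangle Γ t → IsSign (triangleWeight t)
  triangleWeight-sign (i , j , k) ((i<j , j<k) , (i~j , j~k , i~k))
    rewrite indicator-true (i <? j ×-dec j <? k) (i<j , j<k) | symmetric Γ k i =
    IsSign-* (inj₁ refl) (IsSign-* (IsSign-* (IsSign-entry i~j) (IsSign-entry j~k)) (IsSign-entry i~k))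

  nonzero-triangleWeight⇒triangle : ∀ t → triangleWeight t ≢ 0ℤ → IsTriangle Γ t
  nonzero-triangleWeight⇒triangle (i , j , k) w≢0 =
    indicator-nonzero (i <? j ×-dec j <? k) (*-nonzeroˡ (ascending i j k) (cycle³ M i j k) w≢0) ,
    *-nonzeroˡ (M i j) (M j k) Mij*Mjk≢0 , *-nonzeroʳ (M i j) (M j k) Mij*Mjk≢0 ,
    (λ Mik≡0 → Mki≢0 (trans (symmetric Γ k i) Mik≡0))
    where
    cycle≢0 : cycle³ M i j k ≢ 0ℤ
    cycle≢0 = *-nonzeroʳ (ascending i j k) _ w≢0
    Mij*Mjk≢0 : M i j * M j k ≢ 0ℤ
    Mij*Mjk≢0 = *-nonzeroˡ (M i j * M j k) (M k i) cycle≢0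
    Mki≢0 : M k i ≢ 0ℤ
    Mki≢0 = *-nonzeroʳ (M i j * M j k) (M k i) cycle≢0

  triangleWeight-off-triangle : ∀ {t} → ¬ IsTriangle Γ t → triangleWeight t ≡ 0ℤ
  triangleWeight-off-triangle {t} ¬tri =
    decidable-stable (triangleWeight t ℤ.≟ 0ℤ) (¬tri ∘ nonzero-triangleWeight⇒triangle t)

  numTriangles-parity : ∃[ q ] + numTriangles Γ ≡ signedTriangleSum + q * + 2
  numTriangles-parity with length-filter-parity (isTriangle? Γ) (triangleWeight-sign _)
                             triangleWeight-off-triangle (triples n)
  ... | q , e = q , trans e (cong (λ s → s + q * + 2) (∑ˡ-triples triangleWeight))

corollary3p1 : ∀ (n : ℕ) (Γ : SignedGraph n) →
    ¬ (2 ∣ numTriangles Γ) → ¬ SignSymmetric Γ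
corollary3p1 n Γ odd sym-Γ with numTriangles-parity Γ
... | q , count≡ = odd (divides ∣ q ∣ (begin
  numTriangles Γ                        ≡⟨⟩
  ∣ + numTriangles Γ ∣                  ≡⟨ cong ∣_∣ count≡ ⟩
  ∣ signedTriangleSum Γ + q * + 2 ∣     ≡⟨ cong (λ s → ∣ s + q * + 2 ∣) (signSymmetric⇒signedTriangleSum≡0 Γ sym-Γ) ⟩
  ∣ 0ℤ + q * + 2 ∣                      ≡⟨ cong ∣_∣ (ℤP.+-identityˡ (q * + 2)) ⟩
  ∣ q * + 2 ∣                           ≡⟨ ℤP.abs-* q (+ 2) ⟩
  ∣ q ∣ ℕ.* 2                           ∎))
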